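{- Let $n \ge 2$ and fix $t \in \mathbb{N}$. For $E = (\epsilon_0, \ldots, \epsilon_{n-2}) \in \{ -1,1\}^{n-1}$ define $L_0(t,E) = t$ and, for $1 \le j \le n-1$, $L_j(t,E) = t + \sum_{s=2}^{j+1}\epsilon_{n-s}2^{n-s}$. For $0 \le j \le n-1$ let $V_j = \{L_j(t,E) : E \in \{ -1,1\}^{n-1}\}$. Then $V_0 \cup V_1 \cup \cdots \cup V_{n-1}$ equals the integer interval $I(t) = [t-(2^{n-1}-1), t+(2^{n-1}-1)]$ (so the forms take no other values), and each integer in $I(t)$ lies in exactly one of the sets $V_0, \ldots, V_{n-1}$. -}

module Defs where

open import Data.Nat as ℕ using (ℕ; zero; suc)
open import Data.Integer using (ℤ; +_; -_; _+_; _*_; _-_; _≤_)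
open import Data.Fin using (Fin; toℕ)
open import Data.Nat using (_<?_)
open import Data.Fin using (fromℕ<)
open import Relation.Nullary using (yes; no)
open import Data.Product using (_×_)

data Sign : Set where
  plus minus : Sign

⟦_⟧ : Sign → ℤ
⟦ plus ⟧ = + 1
⟦ minus ⟧ = - (+ 1)

-- A sign vector E = (ε_0, …, ε_{n-2}) ∈ {-1,1}^{n-1}, with n - 1 = m.
SignVec : ℕ → Set
SignVec m = Fin m → Sign

-- ε_k 2^k as an integer, for k < m (0 if k ≥ m; never used out of range).
term : ∀ {m} → SignVec m → ℕ → ℤ
term {m} E k with k <? m
... | yes k<m = ⟦ E (fromℕ< k<m) ⟧ * (+ (2 ℕ.^ k))
... | no _ = + 0

-- With n = suc m:  Σ_{s=2}^{j+1} ε_{n-s} 2^{n-s}  =  Σ_{i=0}^{j-1} ε_{m-1-i} 2^{m-1-i}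
-- (substituting i = s - 2, so n - s = m - 1 - i).
partialSum : ∀ {m} → SignVec m → ℕ → ℤ
partialSum E zero = + 0
partialSum {m} E (suc j) = partialSum E j + term E (m ℕ.∸ suc j)

L : ∀ {m} → ℕ → ℕ → SignVec m → ℤ
L t j E = + t + partialSum E j

InI : ℕ → ℕ → ℤ → Set
InI m t x = (+ t - (+ (2 ℕ.^ m) - + 1) ≤ x) × (x ≤ + t + (+ (2 ℕ.^ m) - + 1))

module Submission where

-- Write M = 2^m (so n = m + 1) and call  z = x - (t - M)  the offset of an
-- integer x; the interval I(t) is exactly the set of points with offset
-- 1 ≤ z < 2^(m+1).  The proof rests on one closed form: if k + j = m, the
-- j-th partial sum satisfies
--
--     partialSum E j + 2^m  =  2^k · (2c + 1)      for some c < 2^j,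
--
-- because adding ε·2^k to 2^(k+1)(2c+1) gives 2^k(2c'+1), where c' is c with
-- the binary digit ε (plus ↦ 1, minus ↦ 0) appended.  Conversely, choosing
-- the signs digit by digit realises every c < 2^j at level j.  Since every
-- positive integer is uniquely 2^v·(odd), and 2^v(2c+1) < 2^(m+1) forces
-- v ≤ m and c < 2^(m-v), the offsets of L_j(t,E) range over [1, 2^(m+1)),
-- each offset is attained, and it determines j = m - v.

open import Defs
open import Data.Nat using (ℕ; suc; _≤_; _<_)
open import Data.Integer using (ℤ)
open import Data.Product using (Σ; _×_; ∃)
open import Relation.Binary.PropositionalEquality using (_≡_)

open import Data.Nat using (zero; z≤n; s≤s; z<s; _<?_; _+_; _*_; _∸_; _^_)
import Data.Nat.Properties as ℕₚ
open import Data.Nat.Induction using (<-rec)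
import Data.Nat.Tactic.RingSolver as ℕ-Solver
open import Data.Integer as ℤ using (+_; +≤+)
import Data.Integer.Properties as ℤₚ
import Data.Integer.Tactic.RingSolver as ℤ-Solver
open import Data.Fin using (toℕ; fromℕ<)
open import Data.Fin.Properties using (toℕ-fromℕ<)
open import Data.Product using (_,_; ∃₂)
open import Relation.Nullary using (yes; no)
open import Relation.Nullary.Negation using (contradiction)
open import Relation.Binary.PropositionalEquality
  using (refl; sym; trans; cong; cong₂; subst; module ≡-Reasoning)

appendSign : Sign → ℕ → ℕ
appendSign plus  c = suc (2 * c)
appendSign minus c = 2 * c

appendSign-suc : ∀ s h → appendSign s (suc h) ≡ 2 + appendSign s h
appendSign-suc plus  h = cong suc (ℕₚ.*-suc 2 h)
appendSign-suc minus h = ℕₚ.*-suc 2 h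

appendSign-surjective : ∀ c → ∃₂ λ s h → c ≡ appendSign s h
appendSign-surjective zero          = minus , 0 , refl
appendSign-surjective (suc zero)    = plus , 0 , refl
appendSign-surjective (suc (suc c)) with appendSign-surjective c
... | s , h , c≡ = s , suc h , trans (cong (λ n → 2 + n) c≡) (sym (appendSign-suc s h))

appendSign-< : ∀ s {c n} → c < n → appendSign s c < 2 * n
appendSign-< plus  {c} c<n =
  ℕₚ.≤-trans (ℕₚ.≤-reflexive (sym (ℕₚ.*-suc 2 c))) (ℕₚ.*-monoʳ-≤ 2 c<n)
appendSign-< minus c<n = ℕₚ.≤-trans (ℕₚ.n≤1+n _) (appendSign-< plus c<n)

appendSign-<⁻¹ : ∀ s {h n} → appendSign s h < 2 * n → h < n
appendSign-<⁻¹ plus  {h} lt =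
  ℕₚ.*-cancelˡ-≤ 2 (ℕₚ.≤-trans (ℕₚ.≤-reflexive (ℕₚ.*-suc 2 h)) lt)
appendSign-<⁻¹ minus {h} {n} lt = ℕₚ.*-cancelˡ-< 2 h n lt

half-< : ∀ {w h} → suc w ≡ 2 * suc h → h < w
half-< {w} {h} eq =
  subst (h <_) (sym (ℕₚ.suc-injective (trans eq (ℕₚ.*-suc 2 h))))
        (s≤s (ℕₚ.m≤m+n h (h + 0)))

two-adic-decomposition : ∀ w → ∃₂ λ v c → suc w ≡ 2 ^ v * suc (2 * c)
two-adic-decomposition = <-rec _ decompose
  where
  decompose : ∀ w → (∀ {y} → y < w → ∃₂ λ v c → suc y ≡ 2 ^ v * suc (2 * c)) →
              ∃₂ λ v c → suc w ≡ 2 ^ v * suc (2 * c)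
  decompose w rec with appendSign-surjective (suc w)
  ... | plus  , c , w≡     = 0 , c , trans w≡ (sym (ℕₚ.*-identityˡ _))
  ... | minus , zero , ()
  ... | minus , suc h , w≡ with rec (half-< w≡)
  ...   | v , c , h≡ =
    suc v , c , trans w≡ (trans (cong (2 *_) h≡) (sym (ℕₚ.*-assoc 2 (2 ^ v) _)))

two-adic-unique : ∀ a b c d → 2 ^ a * suc (2 * c) ≡ 2 ^ b * suc (2 * d) → a ≡ b
two-adic-unique zero    zero    c d eq = refl
two-adic-unique zero    (suc b) c d eq = contradiction
  (trans (sym (ℕₚ.*-assoc 2 (2 ^ b) _)) (trans (sym eq) (ℕₚ.*-identityˡ _)))
  (ℕₚ.even≢odd (2 ^ b * suc (2 * d)) c)
two-adic-unique (suc a) zero    c d eq = sym (two-adic-unique zero (suc a) d c (sym eq))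
two-adic-unique (suc a) (suc b) c d eq = cong suc (two-adic-unique a b c d
  (ℕₚ.*-cancelˡ-≡ _ _ 2
    (trans (sym (ℕₚ.*-assoc 2 (2 ^ a) _)) (trans eq (ℕₚ.*-assoc 2 (2 ^ b) _)))))

pow-split : ∀ k j → 2 ^ suc (k + j) ≡ 2 ^ k * 2 ^ suc j
pow-split k j = trans (cong (2 ^_) (sym (ℕₚ.+-suc k j))) (ℕₚ.^-distribˡ-+-* 2 k (suc j))

odd-multiple-< : ∀ k j {n c} → k + j ≡ n → c < 2 ^ j → 2 ^ k * suc (2 * c) < 2 ^ suc n
odd-multiple-< k j {c = c} refl c<2^j = subst (2 ^ k * suc (2 * c) <_) (sym (pow-split k j))
  (ℕₚ.*-monoʳ-< (2 ^ k) {{ℕₚ.m^n≢0 2 k}} (appendSign-< plus c<2^j))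

odd-multiple-<⁻¹ : ∀ k j {n c} → k + j ≡ n → 2 ^ k * suc (2 * c) < 2 ^ suc n → c < 2 ^ j
odd-multiple-<⁻¹ k j {c = c} refl lt = appendSign-<⁻¹ plus
  (ℕₚ.*-cancelˡ-< (2 ^ k) (suc (2 * c)) (2 ^ suc j)
    (subst (2 ^ k * suc (2 * c) <_) (pow-split k j) lt))

odd-multiple-positive : ∀ k c → 1 ≤ 2 ^ k * suc (2 * c)
odd-multiple-positive k c = ℕₚ.*-mono-≤ (ℕₚ.m^n>0 2 k) (s≤s z≤n)

exponent-≤ : ∀ v c {m} → 2 ^ v * suc (2 * c) < 2 ^ suc m → v ≤ m
exponent-≤ v c lt = ℕₚ.≮⇒≥ λ m<v →
  ℕₚ.<⇒≱ lt (ℕₚ.≤-trans (ℕₚ.^-monoʳ-≤ 2 m<v) (ℕₚ.m≤m*n (2 ^ v) (suc (2 * c))))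

undo-shift : ∀ (x a b : ℤ) → (x ℤ.+ (a ℤ.- b)) ℤ.+ (b ℤ.- a) ≡ x
undo-shift = ℤ-Solver.solve-∀

shift-L : ∀ (T S M : ℤ) → (T ℤ.+ S) ℤ.+ (M ℤ.- T) ≡ S ℤ.+ M
shift-L = ℤ-Solver.solve-∀

left-end : ∀ (T M : ℤ) → + 1 ℤ.+ (T ℤ.- M) ≡ T ℤ.- (M ℤ.- + 1)
left-end = ℤ-Solver.solve-∀

left-end⁻¹ : ∀ (T M : ℤ) → (T ℤ.- (M ℤ.- + 1)) ℤ.+ (M ℤ.- T) ≡ + 1
left-end⁻¹ = ℤ-Solver.solve-∀

right-end : ∀ (T M : ℤ) → (M ℤ.+ (M ℤ.+ + 0)) ℤ.+ ((T ℤ.- M) ℤ.- + 1) ≡ T ℤ.+ (M ℤ.- + 1)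
right-end = ℤ-Solver.solve-∀

right-end⁻¹ : ∀ (T M : ℤ) → (T ℤ.+ (M ℤ.- + 1)) ℤ.+ ((M ℤ.- T) ℤ.+ + 1) ≡ M ℤ.+ (M ℤ.+ + 0)
right-end⁻¹ = ℤ-Solver.solve-∀

successor-shift : ∀ (Z T M : ℤ) → (+ 1 ℤ.+ Z) ℤ.+ ((T ℤ.- M) ℤ.- + 1) ≡ Z ℤ.+ (T ℤ.- M)
successor-shift = ℤ-Solver.solve-∀

successor-shift⁻¹ : ∀ (x T M : ℤ) → x ℤ.+ ((M ℤ.- T) ℤ.+ + 1) ≡ + 1 ℤ.+ (x ℤ.+ (M ℤ.- T))
successor-shift⁻¹ = ℤ-Solver.solve-∀

right-swap : ∀ (S T M : ℤ) → (S ℤ.+ T) ℤ.+ M ≡ (S ℤ.+ M) ℤ.+ T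
right-swap = ℤ-Solver.solve-∀

add-sub : ∀ (X P : ℤ) → (X ℤ.+ P) ℤ.- P ≡ X
add-sub = ℤ-Solver.solve-∀

translate-≤ : ∀ {a b a′ b′ : ℤ} c → a ℤ.+ c ≡ a′ → b ℤ.+ c ≡ b′ → a ℤ.≤ b → a′ ℤ.≤ b′
translate-≤ c refl refl a≤b = ℤₚ.+-monoˡ-≤ c a≤b

-- The offset of x is x - (t - 2^m); I(t) is the set of offsets 1 … 2^(m+1) - 1.
offset : ℕ → ℕ → ℤ → ℤ
offset m t x = x ℤ.+ (+ (2 ^ m) ℤ.- + t)

offset-injective : ∀ m t {x y} → offset m t x ≡ offset m t y → x ≡ y
offset-injective m t {x} {y} eq = trans (sym (undo-shift x (+ (2 ^ m)) (+ t)))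
  (trans (cong (ℤ._+ (+ t ℤ.- + (2 ^ m))) eq) (undo-shift y (+ (2 ^ m)) (+ t)))

offset-L : ∀ m t j (E : SignVec m) → offset m t (L t j E) ≡ partialSum E j ℤ.+ + (2 ^ m)
offset-L m t j E = shift-L (+ t) (partialSum E j) (+ (2 ^ m))

InI-fromOffset : ∀ m t x {z} → offset m t x ≡ + z → 1 ≤ z → z < 2 ^ suc m → InI m t x
InI-fromOffset m t x {z} o≡z 1≤z z<2M =
  translate-≤ (T ℤ.- M) (left-end T M) z-to-x (+≤+ 1≤z) ,
  translate-≤ ((T ℤ.- M) ℤ.- + 1) (trans (successor-shift (+ z) T M) z-to-x)
              (right-end T M) (+≤+ z<2M)
  where
  T = + t
  M = + (2 ^ m)
  z-to-x : + z ℤ.+ (T ℤ.- M) ≡ x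
  z-to-x = trans (cong (ℤ._+ (T ℤ.- M)) (sym o≡z)) (undo-shift x M T)

InI-toOffset : ∀ m t x → InI m t x → ∃ λ z → offset m t x ≡ + z × 1 ≤ z × z < 2 ^ suc m
InI-toOffset m t x (lower , upper) = positive
  (translate-≤ (M ℤ.- T) (left-end⁻¹ T M) refl lower)
  (translate-≤ ((M ℤ.- T) ℤ.+ + 1) (successor-shift⁻¹ x T M) (right-end⁻¹ T M) upper)
  where
  T = + t
  M = + (2 ^ m)
  positive : ∀ {o} → + 1 ℤ.≤ o → + 1 ℤ.+ o ℤ.≤ + (2 ^ suc m) →
             ∃ λ z → o ≡ + z × 1 ≤ z × z < 2 ^ suc m
  positive {+ z} (+≤+ 1≤z) bound = z , refl , 1≤z , ℤₚ.drop‿+≤+ bound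

appendSign-step : ∀ s k c →
  + (2 ^ suc k * suc (2 * c)) ℤ.+ ⟦ s ⟧ ℤ.* + (2 ^ k) ≡ + (2 ^ k * suc (2 * appendSign s c))
appendSign-step plus k c = begin
  + (2 ^ suc k * suc (2 * c)) ℤ.+ + 1 ℤ.* + (2 ^ k)
    ≡⟨ cong (λ y → + (2 ^ suc k * suc (2 * c)) ℤ.+ y) (ℤₚ.*-identityˡ (+ (2 ^ k))) ⟩
  + (2 ^ suc k * suc (2 * c) + 2 ^ k)
    ≡⟨ cong +_ (identity (2 ^ k) c) ⟩
  + (2 ^ k * suc (2 * suc (2 * c))) ∎
  where
  open ≡-Reasoning
  identity : ∀ P c → 2 * P * suc (2 * c) + P ≡ P * suc (2 * suc (2 * c))
  identity = ℕ-Solver.solve-∀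
appendSign-step minus k c = begin
  + (2 ^ suc k * suc (2 * c)) ℤ.+ ℤ.- (+ 1) ℤ.* + (2 ^ k)
    ≡⟨ cong (λ y → + (2 ^ suc k * suc (2 * c)) ℤ.+ y) (ℤₚ.-1*i≡-i (+ (2 ^ k))) ⟩
  + (2 ^ suc k * suc (2 * c)) ℤ.- + (2 ^ k)
    ≡⟨ cong (λ a → + a ℤ.- + (2 ^ k)) (identity (2 ^ k) c) ⟩
  + (2 ^ k * suc (2 * (2 * c)) + 2 ^ k) ℤ.- + (2 ^ k)
    ≡⟨ add-sub (+ (2 ^ k * suc (2 * (2 * c)))) (+ (2 ^ k)) ⟩
  + (2 ^ k * suc (2 * (2 * c))) ∎
  where
  open ≡-Reasoning
  identity : ∀ P c → 2 * P * suc (2 * c) ≡ P * suc (2 * (2 * c)) + P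
  identity = ℕ-Solver.solve-∀

sumForm-step : ∀ (S M : ℤ) s k c → S ℤ.+ M ≡ + (2 ^ suc k * suc (2 * c)) →
  (S ℤ.+ ⟦ s ⟧ ℤ.* + (2 ^ k)) ℤ.+ M ≡ + (2 ^ k * suc (2 * appendSign s c))
sumForm-step S M s k c eq =
  trans (right-swap S _ M) (trans (cong (ℤ._+ _) eq) (appendSign-step s k c))

complement-< : ∀ {k j m} → k + suc j ≡ m → k < m
complement-< {k} eq = subst (k <_) eq (ℕₚ.m<m+n k z<s)

complement-index : ∀ {k j m} → k + suc j ≡ m → m ∸ suc j ≡ k
complement-index {k} {j} eq = trans (cong (_∸ suc j) (sym eq)) (ℕₚ.m+n∸n≡m k (suc j))

module _ {m : ℕ} where

  term-sign : ∀ (E : SignVec m) {k} (k<m : k < m) → term E k ≡ ⟦ E (fromℕ< k<m) ⟧ ℤ.* + (2 ^ k)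
  term-sign E {k} k<m with k <? m
  ... | yes _   = refl
  ... | no  k≮m = contradiction k<m k≮m

  partialSum-suc : ∀ (E : SignVec m) {j k} (k<m : k < m) → k + suc j ≡ m →
    partialSum E (suc j) ≡ partialSum E j ℤ.+ ⟦ E (fromℕ< k<m) ⟧ ℤ.* + (2 ^ k)
  partialSum-suc E {j} k<m eq =
    cong (λ y → partialSum E j ℤ.+ y) (trans (cong (term E) (complement-index eq)) (term-sign E k<m))

  SumForm : SignVec m → ℕ → ℕ → ℕ → Set
  SumForm E j k c = partialSum E j ℤ.+ + (2 ^ m) ≡ + (2 ^ k * suc (2 * c))

  sumForm-zero : ∀ (E : SignVec m) {k} → k + 0 ≡ m → SumForm E 0 k 0
  sumForm-zero E {k} eq = cong +_ (sym (trans (ℕₚ.*-identityʳ (2 ^ k))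
    (cong (2 ^_) (trans (sym (ℕₚ.+-identityʳ k)) eq))))

  sumForm-exists : ∀ (E : SignVec m) j {k} → k + j ≡ m → ∃ λ c → c < 2 ^ j × SumForm E j k c
  sumForm-exists E zero    eq = 0 , s≤s z≤n , sumForm-zero E eq
  sumForm-exists E (suc j) {k} eq with sumForm-exists E j {suc k} (trans (sym (ℕₚ.+-suc k j)) eq)
  ... | c , c<2^j , form =
    appendSign s c , appendSign-< s c<2^j ,
    trans (cong (ℤ._+ _) (partialSum-suc E k<m eq))
          (sumForm-step (partialSum E j) (+ (2 ^ m)) s k c form)
    where
    k<m = complement-< eq
    s = E (fromℕ< k<m)

  overrideBelow : ℕ → Sign → SignVec m → SignVec m
  overrideBelow n s E i with toℕ i <? n
  ... | yes _ = s
  ... | no  _ = E i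

  overrideBelow-below : ∀ {n} s E i → toℕ i < n → overrideBelow n s E i ≡ s
  overrideBelow-below {n} s E i i<n with toℕ i <? n
  ... | yes _   = refl
  ... | no  i≮n = contradiction i<n i≮n

  overrideBelow-above : ∀ {n} s E i → n ≤ toℕ i → overrideBelow n s E i ≡ E i
  overrideBelow-above {n} s E i n≤i with toℕ i <? n
  ... | yes i<n = contradiction n≤i (ℕₚ.<⇒≱ i<n)
  ... | no  _   = refl

  partialSum-local : ∀ j {k} (E E′ : SignVec m) → k + j ≡ m →
    (∀ i → k ≤ toℕ i → E i ≡ E′ i) → partialSum E j ≡ partialSum E′ j
  partialSum-local zero    E E′ eq agree = refl
  partialSum-local (suc j) {k} E E′ eq agree = begin
    partialSum E (suc j)
      ≡⟨ partialSum-suc E k<m eq ⟩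
    partialSum E j ℤ.+ ⟦ E (fromℕ< k<m) ⟧ ℤ.* + (2 ^ k)
      ≡⟨ cong₂ (λ S σ → S ℤ.+ ⟦ σ ⟧ ℤ.* + (2 ^ k))
           (partialSum-local j E E′ (trans (sym (ℕₚ.+-suc k j)) eq)
             (λ i k<i → agree i (ℕₚ.<⇒≤ k<i)))
           (agree (fromℕ< k<m) (ℕₚ.≤-reflexive (sym (toℕ-fromℕ< k<m)))) ⟩
    partialSum E′ j ℤ.+ ⟦ E′ (fromℕ< k<m) ⟧ ℤ.* + (2 ^ k)
      ≡⟨ sym (partialSum-suc E′ k<m eq) ⟩
    partialSum E′ (suc j) ∎
    where
    open ≡-Reasoning
    k<m = complement-< eq

  -- Conversely every c < 2^j occurs: choose the signs of indices k, …, m-1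
  -- as the binary digits of c, last digit first.
  sumForm-realised : ∀ j {k} → k + j ≡ m → ∀ c → c < 2 ^ j → ∃ λ E → SumForm E j k c
  sumForm-realised zero    eq zero    _        = (λ _ → plus) , sumForm-zero (λ _ → plus) eq
  sumForm-realised zero    eq (suc c) (s≤s ())
  sumForm-realised (suc j) {k} eq c c<2^[1+j] with appendSign-surjective c
  ... | s , h , refl with sumForm-realised j {suc k} eq′ h (appendSign-<⁻¹ s c<2^[1+j])
    where eq′ = trans (sym (ℕₚ.+-suc k j)) eq
  ... | E′ , form =
    E , trans (cong (ℤ._+ _) step) (sumForm-step (partialSum E′ j) (+ (2 ^ m)) s k h form)
    where
    k<m = complement-< eq
    E = overrideBelow (suc k) s E′
    step : partialSum E (suc j) ≡ partialSum E′ j ℤ.+ ⟦ s ⟧ ℤ.* + (2 ^ k)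
    step = trans (partialSum-suc E k<m eq) (cong₂ (λ S σ → S ℤ.+ ⟦ σ ⟧ ℤ.* + (2 ^ k))
      (partialSum-local j E E′ (trans (sym (ℕₚ.+-suc k j)) eq) (overrideBelow-above s E′))
      (overrideBelow-below s E′ (fromℕ< k<m) (ℕₚ.≤-reflexive (cong suc (toℕ-fromℕ< k<m)))))

  partialSum-range : ∀ (E : SignVec m) {j} → j ≤ m →
    ∃ λ z → partialSum E j ℤ.+ + (2 ^ m) ≡ + z × 1 ≤ z × z < 2 ^ suc m
  partialSum-range E {j} j≤m with sumForm-exists E j (ℕₚ.m∸n+n≡m j≤m)
  ... | c , c<2^j , form =
    _ , form , odd-multiple-positive (m ∸ j) c , odd-multiple-< (m ∸ j) j (ℕₚ.m∸n+n≡m j≤m) c<2^j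

  partialSum-attains : ∀ {z} → 1 ≤ z → z < 2 ^ suc m →
    ∃ λ j → j ≤ m × ∃ λ (E : SignVec m) → partialSum E j ℤ.+ + (2 ^ m) ≡ + z
  partialSum-attains {suc w} _ z<2M with two-adic-decomposition w
  ... | v , c , w≡ with sumForm-realised (m ∸ v) split c (odd-multiple-<⁻¹ v (m ∸ v) split bound)
    where
    bound = subst (_< 2 ^ suc m) w≡ z<2M
    split = ℕₚ.m+[n∸m]≡n (exponent-≤ v c bound)
  ... | E , form = m ∸ v , ℕₚ.m∸n≤m m v , E , trans form (cong +_ (sym w≡))

  level-unique : ∀ {j j′} (E E′ : SignVec m) → j ≤ m → j′ ≤ m →
    partialSum E j ℤ.+ + (2 ^ m) ≡ partialSum E′ j′ ℤ.+ + (2 ^ m) → j ≡ j′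
  level-unique {j} {j′} E E′ j≤m j′≤m same
    with sumForm-exists E j (ℕₚ.m∸n+n≡m j≤m) | sumForm-exists E′ j′ (ℕₚ.m∸n+n≡m j′≤m)
  ... | c , _ , form | c′ , _ , form′ = ℕₚ.∸-cancelˡ-≡ j≤m j′≤m
    (two-adic-unique (m ∸ j) (m ∸ j′) c c′ (ℤₚ.+-injective (trans (sym form) (trans same form′))))

L-in-interval : ∀ m t j → j ≤ m → (E : SignVec m) → InI m t (L t j E)
L-in-interval m t j j≤m E with partialSum-range E j≤m
... | z , form , 1≤z , z<2M = InI-fromOffset m t (L t j E) (trans (offset-L m t j E) form) 1≤z z<2M

interval-unique-level : ∀ m t (x : ℤ) → InI m t x →
  Σ ℕ (λ j → (j ≤ m) × ∃ (λ (E : SignVec m) → L t j E ≡ x)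
    × ((j′ : ℕ) → j′ ≤ m → (E′ : SignVec m) → L t j′ E′ ≡ x → j′ ≡ j))
interval-unique-level m t x x∈I with InI-toOffset m t x x∈I
... | z , o≡z , 1≤z , z<2M with partialSum-attains {m} 1≤z z<2M
... | j , j≤m , E , form = j , j≤m , (E , L≡x) , unique
  where
  L≡x : L t j E ≡ x
  L≡x = offset-injective m t (trans (offset-L m t j E) (trans form (sym o≡z)))
  unique : ∀ j′ → j′ ≤ m → (E′ : SignVec m) → L t j′ E′ ≡ x → j′ ≡ j
  unique j′ j′≤m E′ L′≡x = level-unique E′ E j′≤m j≤m (trans (sym (offset-L m t j′ E′))
    (trans (cong (offset m t) (trans L′≡x (sym L≡x))) (offset-L m t j E)))

lemma2p12 : (m : ℕ) → 1 ≤ m → (t : ℕ) →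
    ((j : ℕ) → j ≤ m → (E : SignVec m) → InI m t (L t j E))
    × ((x : ℤ) → InI m t x →
        Σ ℕ (λ j → (j ≤ m) × ∃ (λ (E : SignVec m) → L t j E ≡ x)
          × ((j′ : ℕ) → j′ ≤ m → (E′ : SignVec m) → L t j′ E′ ≡ x → j′ ≡ j)))
lemma2p12 m _ t = L-in-interval m t , interval-unique-level m t
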